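{- Let $g\ge3$ and $2\le k<g$ be integers such that the $(g,k)$ Young graph exists. Then the $(g,k)$ Young graph is a complete graph $K_m$ (for some $m$) if and only if every non-starting node of it has a label of the form $[r,r]$.
   Context: Notation: $(a_{n-1},\dots,a_1,a_0)_g$ denotes $\sum_{i=0}^{n-1}a_ig^i$ with digits $0\le a_i<g$. A positive integer $N=(a_{n-1},\dots,a_0)_g$ with $a_{n-1}\neq 0$ is a $(g,k)$-reverse multiple if $kN=(a_0,a_1,\dots,a_{n-1})_g$. Young graph. The directed edge-labelled graph $H(g,k)$ is defined as follows. Its possible nodes are a distinguished starting node, written $[[0,0]]$, and ordered pairs $[s,r]$ of integers with $0\le s,r\le k-1$ (the pair $[0,0]$ is a node distinct from the starting node). For a node $[s,r]$ (the starting node being treated as $s=r=0$) and each pair of digits $(c,a)$, $0\le a,c\le g-1$, with $ka+r\equiv c \pmod g$ and $0\le a+sg-kc\le k-1$, there is a directed edge labelled $(c,a)$ from $[s,r]$ to the node $[\,a+sg-kc,\ (ka+r-c)/g\,]$; for edges leaving the starting node one additionally requires $a\ne0$ and $c\ne0$. $H(g,k)$ consists of the starting node, the nodes reachable from it by directed paths, and all edges leaving these nodes. A non-starting node of the form $[r,r]$ ($r\ge0$, including $[0,0]$) is an even pivot node; a non-starting node is an odd pivot node if it is of the form $[r,r]$ and carries a loop, or is of the form $[r',r]$ with $r'\ne r$ and has an edge to $[r,r']$. The $(g,k)$ Young graph exists if $H(g,k)$ contains a node $[r,r]$ with $r\ne0$ or an edge $[r',r]\to[r,r']$ with $r'\ne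 r$; it is then obtained from $H(g,k)$ by deleting every node from which no pivot node can be reached by a directed path, together with all edges incident to such nodes. Complete graph $K_m$: a Young graph is the complete graph $K_m$ if it has exactly $m$ non-starting nodes, there is a directed edge from every non-starting node to every non-starting node (including a loop at each non-starting node, $m^2$ edges in all), and the starting node has an edge to every non-starting node except $[0,0]$. -}

module Defs where

open import Data.Nat using (ℕ; _+_; _*_; _∸_; _≤_; _<_)
open import Data.Product using (Σ; ∃; _×_; _,_)
open import Data.Sum using (_⊎_)
open import Data.Unit using (⊤)
open import Data.List using (List; length)
open import Data.List.Membership.Propositional using (_∈_)
open import Data.List.Relation.Unary.Unique.Propositional using (Unique)
open import Relation.Nullary using (¬_)
open import Relation.Binary.PropositionalEquality using (_≡_; _≢_)
open import Relation.Binary.Construct.Closure.ReflexiveTransitive using (Star)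
open import Function.Bundles using (_⇔_)

-- Nodes of H(g,k): the distinguished starting node [[0,0]], or a pair [s,r].
-- (Only pairs with 0 ≤ s,r ≤ k-1 ever arise as edge targets.)
data Node : Set where
  start : Node
  nd    : ℕ → ℕ → Node

sOf : Node → ℕ
sOf start    = 0
sOf (nd s r) = s

rOf : Node → ℕ
rOf start    = 0
rOf (nd s r) = r

StartCond : Node → ℕ → ℕ → Set
StartCond start    c a = (a ≢ 0) × (c ≢ 0)
StartCond (nd _ _) c a = ⊤

-- The congruence k a + r ≡ c (mod g) is witnessed by q with k a + r = c + q g,
-- so that q = (k a + r - c)/g is the second coordinate of the target.
Edge : ℕ → ℕ → Node → ℕ → ℕ → Node → Set
Edge g k u c a v =
  c < g × a < g × StartCond u c a ×
  (k * c ≤ a + sOf u * g) × (a + sOf u * g ∸ k * c < k) ×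
  Σ ℕ λ q → (k * a + rOf u ≡ c + q * g) × (v ≡ nd (a + sOf u * g ∸ k * c) q)

Step : ℕ → ℕ → Node → Node → Set
Step g k u v = ∃ λ c → ∃ λ a → Edge g k u c a v

Reach : ℕ → ℕ → Node → Node → Set
Reach g k = Star (Step g k)

InH : ℕ → ℕ → Node → Set
InH g k u = Reach g k start u

-- pivot node (even: [r,r]; odd: [r,r] with a loop — subsumed — or
-- [r',r], r' ≠ r, with an edge to [r,r'])
Pivot : ℕ → ℕ → Node → Set
Pivot g k u = ∃ λ s → ∃ λ r → (u ≡ nd s r) ×
  ((s ≡ r) ⊎ ((s ≢ r) × Step g k (nd s r) (nd r s)))

YoungExists : ℕ → ℕ → Set
YoungExists g k =
  (∃ λ r → (r ≢ 0) × InH g k (nd r r)) ⊎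
  (∃ λ r' → ∃ λ r → (r' ≢ r) × InH g k (nd r' r) × Step g k (nd r' r) (nd r r'))

YoungNode : ℕ → ℕ → Node → Set
YoungNode g k u = InH g k u × ∃ λ v → Reach g k u v × Pivot g k v

IsComplete : ℕ → ℕ → ℕ → Set
IsComplete g k m =
  (Σ (List (ℕ × ℕ)) λ xs → (length xs ≡ m) × Unique xs ×
     (∀ s r → ((s , r) ∈ xs) ⇔ YoungNode g k (nd s r))) ×
  (∀ s r s' r' → YoungNode g k (nd s r) → YoungNode g k (nd s' r') →
     Σ (ℕ × ℕ) λ { (c , a) → Edge g k (nd s r) c a (nd s' r') ×
       (∀ c' a' → Edge g k (nd s r) c' a' (nd s' r') → (c' , a') ≡ (c , a)) }) ×
  (∀ s r → YoungNode g k (nd s r) → ¬ ((s ≡ 0) × (r ≡ 0)) → Step g k start (nd s r))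

-- Write β = g − k, M = k² − 1 and α = kg − 1 = M + kβ. Eliminating a from the two
-- equations a + s′g = s + kc and ka + r′ = c + rg of an edge [s′,r′] → [s,r] shows that
-- Mc is determined by the endpoints; between diagonal nodes [ρ,ρ] → [r,r] this reads
-- Mc = βr + ρα, and then Ma = rα + βρ. So if every Young node is diagonal, an induction
-- along paths shows that the Young nodes are exactly the [r,r] with r < k and M ∣ βr, and
-- these formulas produce exactly one edge between any two of them, and one from the start
-- to each of them but [0,0]: the graph is complete. Conversely, in a complete graph a
-- non-zero node [s,r] has an edge from the start and a loop; eliminating the labels gives
-- r² ≡ s² (mod M), and s, r < k forces both squares below M, hence s = r.

module Submission where

open import Defs
open import Data.Nat using (ℕ; _≤_; _<_)
open import Data.Product using (∃)
open import Relation.Binary.PropositionalEquality using (_≡_)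
open import Function.Bundles using (_⇔_)

open import Data.Nat using (zero; suc; _+_; _*_; _∸_; _%_; s≤s; z<s; NonZero; >-nonZero⁻¹)
open import Data.Nat.Properties
open import Data.Nat.DivMod using ([m+kn]%n≡m%n; m<n⇒m%n≡m)
open import Data.Nat.Divisibility using (_∣_; divides; _∣?_; _∣0; ∣m∣n⇒∣m+n; ∣m+n∣m⇒∣n; n∣m*n; ∣n⇒∣m*n)
open import Data.Nat.Tactic.RingSolver using (solve)
open import Data.Product using (∃₂; _×_; _,_; proj₁; proj₂; uncurry)
open import Data.Sum using (inj₁; inj₂)
open import Data.Unit using (tt)
open import Data.Empty using (⊥-elim)
open import Data.List using (List; []; _∷_; map; filter; upTo; length)
open import Data.List.Membership.Propositional using (_∈_)
open import Data.List.Membership.Propositional.Properties using (∈-upTo⁺; ∈-upTo⁻; ∈-map∘filter⁺; ∈-map∘filter⁻)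
import Data.List.Relation.Unary.Unique.Propositional.Properties as Unique
open import Relation.Nullary using (¬_; contradiction)
open import Relation.Binary.Definitions using (tri<; tri≈; tri>)
open import Relation.Binary.PropositionalEquality using (_≢_; refl; sym; trans; cong; cong₂; subst; module ≡-Reasoning)
open import Relation.Binary.Construct.Closure.ReflexiveTransitive using (ε; _◅_; _◅◅_)
open import Function.Bundles using (mk⇔)

square-injective : ∀ {m n} → m * m ≡ n * n → m ≡ n
square-injective {m} {n} eq with <-cmp m n
... | tri< m<n _ _ = contradiction eq (<⇒≢ (*-mono-< m<n m<n))
... | tri≈ _ m≡n _ = m≡n
... | tri> _ _ n<m = contradiction eq (>⇒≢ (*-mono-< n<m n<m))

<⇒∃[o]m+1+o≡n : ∀ {m n} → m < n → ∃ λ o → m + suc o ≡ n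
<⇒∃[o]m+1+o≡n {m} m<n with o , eq ← m≤n⇒∃[o]m+o≡n m<n = o , trans (+-suc m o) eq

Diagonal : ℕ → ℕ → Set
Diagonal g k = ∀ s r → YoungNode g k (nd s r) → s ≡ r

even-pivot : ∀ {g k} r → Pivot g k (nd r r)
even-pivot r = r , r , refl , inj₁ refl

edge-equations : ∀ {g k u c a s r} → Edge g k u c a (nd s r) →
  (a + sOf u * g ≡ s + k * c) × (k * a + rOf u ≡ c + r * g)
edge-equations (_ , _ , _ , kc≤ , _ , _ , e₂ , refl) = sym (m∸n+n≡m kc≤) , e₂

edge-of-equations : ∀ {g k u c a s r} → c < g → a < g → StartCond u c a → s < k →
  a + sOf u * g ≡ s + k * c → k * a + rOf u ≡ c + r * g → Edge g k u c a (nd s r)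
edge-of-equations {g} {k} {u} {c} {a} {s} {r} c<g a<g cond s<k e₁ e₂ =
  c<g , a<g , cond , kc≤ , subst (_< k) (sym difference) s<k , r , e₂ , cong (λ t → nd t r) (sym difference)
  where
  difference : a + sOf u * g ∸ k * c ≡ s
  difference = trans (cong (_∸ k * c) e₁) (m+n∸n≡m s (k * c))
  kc≤ : k * c ≤ a + sOf u * g
  kc≤ = subst (k * c ≤_) (sym e₁) (m≤n+m (k * c) s)

edge-target-< : ∀ {g k u c a s r} → Edge g k u c a (nd s r) → s < k
edge-target-< (_ , _ , _ , _ , s<k , _ , _ , refl) = s<k

edge-target-r< : ∀ {g k u c a s r} → rOf u < k → Edge g k u c a (nd s r) → r < k
edge-target-r< {g} {k} {u} {c} {a} {s} {r} ρ<k e@(_ , a<g , _) = *-cancelʳ-< g r k (begin-strict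
  r * g         ≤⟨ m≤n+m (r * g) c ⟩
  c + r * g     ≡⟨ proj₂ (edge-equations e) ⟨
  k * a + rOf u <⟨ +-monoʳ-< (k * a) ρ<k ⟩
  k * a + k     ≡⟨ +-comm (k * a) k ⟩
  k + k * a     ≡⟨ *-suc k a ⟨
  k * suc a     ≤⟨ *-monoʳ-≤ k a<g ⟩
  k * g         ∎)
  where open ≤-Reasoning

-- M stands for k² − 1; it is a variable so that no truncated subtraction occurs.
module _ {k M : ℕ} (k*k≡1+M : k * k ≡ suc M) where

  0<k : 0 < k
  0<k = *-cancelʳ-< k 0 k (subst (0 <_) (sym k*k≡1+M) z<s)

  k*[k*x]≡x+M*x : ∀ x → k * (k * x) ≡ x + M * x
  k*[k*x]≡x+M*x x = trans (sym (*-assoc k k x)) (cong (_* x) k*k≡1+M)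

  square-below : .{{_ : NonZero M}} → ∀ {s} → s < k → s * s < M
  square-below {zero}    _   = >-nonZero⁻¹ M
  square-below {s@(suc t)} s<k = ≤-pred (begin-strict
    suc (s * s)   ≤⟨ s≤s (m≤n+m (s * s) t) ⟩
    s + s * s     ≡⟨ *-suc s s ⟨
    s * suc s     <⟨ *-monoˡ-< (suc s) (n<1+n s) ⟩
    suc s * suc s ≤⟨ *-mono-≤ s<k s<k ⟩
    k * k         ≡⟨ k*k≡1+M ⟩
    suc M         ∎)
    where open ≤-Reasoning

  edge-system⇒c*M : ∀ {g σ ρ s r a c} → a + σ * g ≡ s + k * c → k * a + ρ ≡ c + r * g →
    c * M + ρ + k * s ≡ r * g + k * (σ * g)
  edge-system⇒c*M {g} {σ} {ρ} {s} {r} {a} {c} e₁ e₂ = +-cancelˡ-≡ c _ _ (begin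
    c + (c * M + ρ + k * s)   ≡⟨ solve (c ∷ M ∷ ρ ∷ k ∷ s ∷ []) ⟩
    c + M * c + k * s + ρ     ≡⟨ cong (λ t → t + k * s + ρ) (k*[k*x]≡x+M*x c) ⟨
    k * (k * c) + k * s + ρ   ≡⟨ solve (k ∷ c ∷ s ∷ ρ ∷ []) ⟩
    k * (s + k * c) + ρ       ≡⟨ cong (λ t → k * t + ρ) e₁ ⟨
    k * (a + σ * g) + ρ       ≡⟨ solve (k ∷ a ∷ σ ∷ g ∷ ρ ∷ []) ⟩
    k * a + ρ + k * (σ * g)   ≡⟨ cong (_+ k * (σ * g)) e₂ ⟩
    c + r * g + k * (σ * g)   ≡⟨ +-assoc c (r * g) (k * (σ * g)) ⟩
    c + (r * g + k * (σ * g)) ∎)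
    where open ≡-Reasoning

  edge⇒c*M : ∀ {g u c a s r} → Edge g k u c a (nd s r) → c * M + rOf u + k * s ≡ r * g + k * (sOf u * g)
  edge⇒c*M {g} {u} {c} {a} {s} {r} e =
    uncurry (edge-system⇒c*M {g} {sOf u} {rOf u} {s} {r} {a} {c}) (edge-equations e)

  diagonal-edge⇒c*M : ∀ {β u c a ρ r} → sOf u ≡ ρ → rOf u ≡ ρ → Edge (k + β) k u c a (nd r r) →
    c * M ≡ β * r + ρ * (M + k * β)
  diagonal-edge⇒c*M {β} {u} {c} {a} {ρ} {r} sOf≡ρ rOf≡ρ e = +-cancelʳ-≡ (ρ + k * r) _ _ (begin
    c * M + (ρ + k * r)                          ≡⟨ +-assoc (c * M) ρ (k * r) ⟨
    c * M + ρ + k * r                            ≡⟨ cong (λ t → c * M + t + k * r) rOf≡ρ ⟨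
    c * M + rOf u + k * r                        ≡⟨ edge⇒c*M e ⟩
    r * (k + β) + k * (sOf u * (k + β))          ≡⟨ cong (λ σ → r * (k + β) + k * (σ * (k + β))) sOf≡ρ ⟩
    r * (k + β) + k * (ρ * (k + β))              ≡⟨ solve (r ∷ k ∷ β ∷ ρ ∷ []) ⟩
    β * r + k * (k * ρ) + k * (ρ * β) + k * r    ≡⟨ cong (λ t → β * r + t + k * (ρ * β) + k * r) (k*[k*x]≡x+M*x ρ) ⟩
    β * r + (ρ + M * ρ) + k * (ρ * β) + k * r    ≡⟨ solve (β ∷ r ∷ ρ ∷ M ∷ k ∷ []) ⟩
    β * r + ρ * (M + k * β) + (ρ + k * r)        ∎)
    where open ≡-Reasoning

  c*M,a*M⇒diagonal-system : .{{_ : NonZero M}} → ∀ {β ρ r a c} →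
    c * M ≡ β * r + ρ * (M + k * β) → a * M ≡ r * (M + k * β) + β * ρ →
    (a + ρ * (k + β) ≡ r + k * c) × (k * a + ρ ≡ c + r * (k + β))
  c*M,a*M⇒diagonal-system {β} {ρ} {r} {a} {c} cM aM = *-cancelʳ-≡ _ _ M first , *-cancelʳ-≡ _ _ M second
    where
    open ≡-Reasoning
    first : (a + ρ * (k + β)) * M ≡ (r + k * c) * M
    first = begin
      (a + ρ * (k + β)) * M                                   ≡⟨ solve (a ∷ ρ ∷ k ∷ β ∷ M ∷ []) ⟩
      a * M + ρ * (k + β) * M                                 ≡⟨ cong (_+ ρ * (k + β) * M) aM ⟩
      r * (M + k * β) + β * ρ + ρ * (k + β) * M               ≡⟨ solve (r ∷ M ∷ k ∷ β ∷ ρ ∷ []) ⟩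
      r * M + k * (β * r) + k * (ρ * M) + (β * ρ + M * (β * ρ)) ≡⟨ cong (r * M + k * (β * r) + k * (ρ * M) +_) (k*[k*x]≡x+M*x (β * ρ)) ⟨
      r * M + k * (β * r) + k * (ρ * M) + k * (k * (β * ρ))   ≡⟨ solve (r ∷ M ∷ k ∷ β ∷ ρ ∷ []) ⟩
      r * M + k * (β * r + ρ * (M + k * β))                   ≡⟨ cong (λ t → r * M + k * t) cM ⟨
      r * M + k * (c * M)                                     ≡⟨ solve (r ∷ M ∷ k ∷ c ∷ []) ⟩
      (r + k * c) * M                                         ∎
    second : (k * a + ρ) * M ≡ (c + r * (k + β)) * M
    second = begin
      (k * a + ρ) * M                                         ≡⟨ solve (k ∷ a ∷ ρ ∷ M ∷ []) ⟩
      k * (a * M) + ρ * M                                     ≡⟨ cong (λ t → k * t + ρ * M) aM ⟩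
      k * (r * (M + k * β) + β * ρ) + ρ * M                   ≡⟨ solve (k ∷ r ∷ M ∷ β ∷ ρ ∷ []) ⟩
      k * (r * M) + k * (k * (β * r)) + k * (β * ρ) + ρ * M   ≡⟨ cong (λ t → k * (r * M) + t + k * (β * ρ) + ρ * M) (k*[k*x]≡x+M*x (β * r)) ⟩
      k * (r * M) + (β * r + M * (β * r)) + k * (β * ρ) + ρ * M ≡⟨ solve (k ∷ r ∷ M ∷ β ∷ ρ ∷ []) ⟩
      β * r + ρ * (M + k * β) + r * (k + β) * M               ≡⟨ cong (_+ r * (k + β) * M) cM ⟨
      c * M + r * (k + β) * M                                 ≡⟨ solve (c ∷ M ∷ r ∷ k ∷ β ∷ []) ⟩
      (c + r * (k + β)) * M                                   ∎

  label-numerator<g*M : .{{_ : NonZero M}} → ∀ {β x y} → x < k → y < k → x * (M + k * β) + β * y < (k + β) * M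
  label-numerator<g*M {β} {x} {y} x<k y<k = +-cancelʳ-≤ (M + k * β + β) _ _ (begin
    suc (x * (M + k * β) + β * y) + (M + k * β + β) ≡⟨ solve (x ∷ M ∷ k ∷ β ∷ y ∷ []) ⟩
    suc x * (M + k * β) + β * suc y + 1             ≤⟨ +-mono-≤ (+-mono-≤ (*-monoˡ-≤ (M + k * β) x<k) (*-monoʳ-≤ β y<k)) (>-nonZero⁻¹ M) ⟩
    k * (M + k * β) + β * k + M                     ≡⟨ solve (k ∷ M ∷ β ∷ []) ⟩
    k * (k * β) + M * k + β * k + M                 ≡⟨ cong (λ t → t + M * k + β * k + M) (k*[k*x]≡x+M*x β) ⟩
    β + M * β + M * k + β * k + M                   ≡⟨ solve (β ∷ M ∷ k ∷ []) ⟩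
    (k + β) * M + (M + k * β + β)                   ∎)
    where open ≤-Reasoning

  edge-label-unique : .{{_ : NonZero M}} → ∀ {g u c a c′ a′ s r} →
    Edge g k u c a (nd s r) → Edge g k u c′ a′ (nd s r) → (c′ , a′) ≡ (c , a)
  edge-label-unique {g} {u} {c} {a} {c′} {a′} {s} {r} e e′ = cong₂ _,_ c′≡c a′≡a
    where
    c′≡c : c′ ≡ c
    c′≡c = *-cancelʳ-≡ c′ c M (+-cancelʳ-≡ _ _ _ (+-cancelʳ-≡ _ _ _ (trans (edge⇒c*M e′) (sym (edge⇒c*M e)))))
    a′≡a : a′ ≡ a
    a′≡a = +-cancelʳ-≡ _ _ _ (begin
      a′ + sOf u * g ≡⟨ proj₁ (edge-equations e′) ⟩
      s + k * c′     ≡⟨ cong (λ t → s + k * t) c′≡c ⟩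
      s + k * c      ≡⟨ proj₁ (edge-equations e) ⟨
      a + sOf u * g  ∎)
      where open ≡-Reasoning

  start-loop⇒squares-congruent : .{{_ : NonZero M}} → ∀ {g s r c₀ a₀ c a} →
    Edge g k start c₀ a₀ (nd s r) → Edge g k (nd s r) c a (nd s r) → r * r % M ≡ s * s % M
  start-loop⇒squares-congruent {g} {s} {r} {c₀} {a₀} {c} {a} e₀ e = begin
    r * r % M                                             ≡⟨ [m+kn]%n≡m%n (r * r) (c * r) M ⟨
    (r * r + c * r * M) % M                               ≡⟨ cong (_% M) squares ⟩
    (s * s + (c₀ * r + s * s + k * (s * c₀)) * M) % M     ≡⟨ [m+kn]%n≡m%n (s * s) (c₀ * r + s * s + k * (s * c₀)) M ⟩
    s * s % M                                             ∎
    where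
    open ≡-Reasoning
    start-eq : r * g ≡ c₀ * M + k * s
    start-eq = begin
      r * g                   ≡⟨ solve (r ∷ g ∷ k ∷ []) ⟩
      r * g + k * (0 * g)     ≡⟨ edge⇒c*M e₀ ⟨
      c₀ * M + 0 + k * s      ≡⟨ solve (c₀ ∷ M ∷ k ∷ s ∷ []) ⟩
      c₀ * M + k * s          ∎
    loop-eq : c * M + r ≡ c₀ * M + k * (s * g)
    loop-eq = +-cancelʳ-≡ (k * s) _ _ (begin
      c * M + r + k * s              ≡⟨ edge⇒c*M {g} {nd s r} {c} {a} e ⟩
      r * g + k * (s * g)            ≡⟨ cong (_+ k * (s * g)) start-eq ⟩
      c₀ * M + k * s + k * (s * g)   ≡⟨ solve (c₀ ∷ M ∷ k ∷ s ∷ g ∷ []) ⟩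
      c₀ * M + k * (s * g) + k * s   ∎)
    squares : r * r + c * r * M ≡ s * s + (c₀ * r + s * s + k * (s * c₀)) * M
    squares = begin
      r * r + c * r * M                                     ≡⟨ solve (r ∷ c ∷ M ∷ []) ⟩
      r * (c * M + r)                                       ≡⟨ cong (r *_) loop-eq ⟩
      r * (c₀ * M + k * (s * g))                            ≡⟨ solve (r ∷ c₀ ∷ M ∷ k ∷ s ∷ g ∷ []) ⟩
      c₀ * r * M + k * s * (r * g)                          ≡⟨ cong (λ t → c₀ * r * M + k * s * t) start-eq ⟩
      c₀ * r * M + k * s * (c₀ * M + k * s)                 ≡⟨ solve (c₀ ∷ r ∷ M ∷ k ∷ s ∷ []) ⟩
      c₀ * r * M + k * (s * c₀) * M + k * (k * (s * s))     ≡⟨ cong (c₀ * r * M + k * (s * c₀) * M +_) (k*[k*x]≡x+M*x (s * s)) ⟩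
      c₀ * r * M + k * (s * c₀) * M + (s * s + M * (s * s)) ≡⟨ solve (c₀ ∷ r ∷ M ∷ k ∷ s ∷ []) ⟩
      s * s + (c₀ * r + s * s + k * (s * c₀)) * M           ∎

  start-loop⇒diagonal : .{{_ : NonZero M}} → ∀ {g s r c₀ a₀ c a} →
    Edge g k start c₀ a₀ (nd s r) → Edge g k (nd s r) c a (nd s r) → s ≡ r
  start-loop⇒diagonal {g} {s} {r} {c₀} {a₀} {c} {a} e₀ e = sym (square-injective (begin
    r * r     ≡⟨ m<n⇒m%n≡m (square-below (edge-target-r< 0<k e₀)) ⟨
    r * r % M ≡⟨ start-loop⇒squares-congruent {g} {s} {r} {c₀} {a₀} {c} {a} e₀ e ⟩
    s * s % M ≡⟨ m<n⇒m%n≡m (square-below (edge-target-< e₀)) ⟩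
    s * s     ∎))
    where open ≡-Reasoning

  complete⇒diagonal : .{{_ : NonZero M}} → ∀ {g} → ∃ (IsComplete g k) → Diagonal g k
  complete⇒diagonal {g} (_ , _ , loops , starts) = diagonal
    where
    entered-from-start : ∀ {s r} → YoungNode g k (nd s r) → ¬ (s ≡ 0 × r ≡ 0) → s ≡ r
    entered-from-start {s} {r} y nonzero
      with c₀ , a₀ , e₀ ← starts s r y nonzero | (c , a) , e , _ ← loops s r s r y y
      = start-loop⇒diagonal e₀ e
    diagonal : Diagonal g k
    diagonal zero    zero    _ = refl
    diagonal (suc s) r       y = entered-from-start y λ { (() , _) }
    diagonal zero    (suc r) y = entered-from-start y λ { (_ , ()) }

module DiagonalYoungGraph {k β M : ℕ} (k*k≡1+M : k * k ≡ suc M) .{{_ : NonZero M}} .{{_ : NonZero β}} where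

  g α : ℕ
  g = k + β
  α = M + k * β

  Admissible : ℕ → Set
  Admissible r = r < k × M ∣ β * r

  Balanced : Node → Set
  Balanced u = sOf u ≡ rOf u × Admissible (rOf u)

  start-balanced : Balanced start
  start-balanced = refl , 0<k k*k≡1+M , subst (M ∣_) (sym (*-zeroʳ β)) (M ∣0)

  M∣β*ρ⇒M∣ρ*α : ∀ {ρ} → M ∣ β * ρ → M ∣ ρ * α
  M∣β*ρ⇒M∣ρ*α {ρ} M∣βρ = subst (M ∣_) ρ*M+k*[β*ρ]≡ρ*α (∣m∣n⇒∣m+n (n∣m*n ρ) (∣n⇒∣m*n k M∣βρ))
    where
    ρ*M+k*[β*ρ]≡ρ*α : ρ * M + k * (β * ρ) ≡ ρ * (M + k * β)
    ρ*M+k*[β*ρ]≡ρ*α = solve (ρ ∷ M ∷ k ∷ β ∷ [])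

  edge-preserves-balance : ∀ {u c a r} → Balanced u → Edge g k u c a (nd r r) → Balanced (nd r r)
  edge-preserves-balance {u} {c} {a} {r} (sOf≡rOf , _ , M∣βρ) e =
    refl , edge-target-< e , ∣m+n∣m⇒∣n (divides c (trans (+-comm (rOf u * α) (β * r)) (sym c*M))) (M∣β*ρ⇒M∣ρ*α M∣βρ)
    where
    c*M : c * M ≡ β * r + rOf u * α
    c*M = diagonal-edge⇒c*M k*k≡1+M sOf≡rOf refl e

  -- A node on a path from the start to a pivot is itself a Young node, hence diagonal.
  young-step-balanced : Diagonal g k → ∀ {u v} → InH g k u → Balanced u → (st : Step g k u v) →
    ∃ (λ w → Reach g k v w × Pivot g k w) → Balanced v
  young-step-balanced diagonal {u} hu bu st@(c , a , e@(_ , _ , _ , _ , _ , q , _ , refl)) reaches-pivot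
    with refl ← diagonal _ q (hu ◅◅ (st ◅ ε) , reaches-pivot)
    = edge-preserves-balance bu e

  balanced-along : Diagonal g k → ∀ {u v w} → InH g k u → Balanced u →
    Reach g k u v → Reach g k v w → Pivot g k w → Balanced v
  balanced-along diagonal hu bu ε _ _ = bu
  balanced-along diagonal hu bu (st ◅ path) vw pw =
    balanced-along diagonal (hu ◅◅ (st ◅ ε)) (young-step-balanced diagonal hu bu st (_ , path ◅◅ vw , pw)) path vw pw

  young⇒balanced : Diagonal g k → ∀ {v} → YoungNode g k v → Balanced v
  young⇒balanced diagonal (path , _ , vw , pw) = balanced-along diagonal ε start-balanced path vw pw

  -- The quotients of the two formulas of the header; they are integers by admissibility.
  admissible-label : ∀ {ρ r} → Admissible ρ → Admissible r →
    ∃₂ λ c a → c < g × a < g × c * M ≡ β * r + ρ * α × a * M ≡ r * α + β * ρ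
  admissible-label {ρ} {r} (ρ<k , M∣βρ) (r<k , M∣βr)
    with divides c βr+ρα≡c*M ← ∣m∣n⇒∣m+n M∣βr (M∣β*ρ⇒M∣ρ*α M∣βρ)
       | divides a rα+βρ≡a*M ← ∣m∣n⇒∣m+n (M∣β*ρ⇒M∣ρ*α M∣βr) M∣βρ
    = c , a , c<g , a<g , sym βr+ρα≡c*M , sym rα+βρ≡a*M
    where
    c<g : c < g
    c<g = *-cancelʳ-< M c g (subst (_< g * M) (trans (+-comm (ρ * α) (β * r)) βr+ρα≡c*M) (label-numerator<g*M k*k≡1+M ρ<k r<k))
    a<g : a < g
    a<g = *-cancelʳ-< M a g (subst (_< g * M) rα+βρ≡a*M (label-numerator<g*M k*k≡1+M r<k ρ<k))

  edge-of-label : ∀ {u c a r} → sOf u ≡ rOf u → r < k → c < g → a < g →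
    c * M ≡ β * r + rOf u * α → a * M ≡ r * α + β * rOf u → StartCond u c a → Edge g k u c a (nd r r)
  edge-of-label {u} {c} {a} {r} sOf≡rOf r<k c<g a<g c*M a*M cond with e₁ , e₂ ← c*M,a*M⇒diagonal-system k*k≡1+M {β} {rOf u} {r} {a} {c} c*M a*M =
    edge-of-equations c<g a<g cond r<k (subst (λ σ → a + σ * g ≡ r + k * c) (sym sOf≡rOf) e₁) e₂

  diagonal-edge : ∀ {ρ r} → Admissible ρ → Admissible r → ∃₂ λ c a → Edge g k (nd ρ ρ) c a (nd r r)
  diagonal-edge aρ ar@(r<k , _) with c , a , c<g , a<g , c*M , a*M ← admissible-label aρ ar =
    c , a , edge-of-label refl r<k c<g a<g c*M a*M tt

  start-edge : ∀ {r} → r ≢ 0 → Admissible r → Step g k start (nd r r)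
  start-edge {r} r≢0 ar@(r<k , _) with c , a , c<g , a<g , c*M , a*M ← admissible-label (proj₂ start-balanced) ar =
    c , a , edge-of-label refl r<k c<g a<g c*M a*M (a≢0 , c≢0)
    where
    c≢0 : c ≢ 0
    c≢0 refl = r≢0 (m*n≡0⇒m≡0 r β (trans (*-comm r β) (m+n≡0⇒m≡0 (β * r) (sym c*M))))
    a≢0 : a ≢ 0
    a≢0 refl = r≢0 (m*n≡0⇒m≡0 r M (n≤0⇒n≡0 (begin
      r * M         ≤⟨ *-monoʳ-≤ r (m≤m+n M (k * β)) ⟩
      r * α         ≤⟨ m≤m+n (r * α) (β * 0) ⟩
      r * α + β * 0 ≡⟨ a*M ⟨
      0             ∎)))
      where open ≤-Reasoning

  admissible⇒young : YoungExists g k → Diagonal g k → ∀ {r} → Admissible r → YoungNode g k (nd r r)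
  admissible⇒young _ _ {suc r} ar = (start-edge (λ ()) ar ◅ ε) , _ , ε , even-pivot (suc r)
  -- [0,0] is reached through a non-zero diagonal Young node, which the existence hypothesis
  -- provides (its other alternative contradicts diagonality).
  admissible⇒young (inj₁ (r₀ , _ , in-H)) diagonal {zero} ar = in-H ◅◅ (step ◅ ε) , _ , ε , even-pivot 0
    where
    ar₀ : Admissible r₀
    ar₀ = proj₂ (young⇒balanced diagonal (in-H , _ , ε , even-pivot r₀))
    step : Step g k (nd r₀ r₀) (nd 0 0)
    step = diagonal-edge ar₀ ar
  admissible⇒young (inj₂ (r′ , r , r′≢r , in-H , st)) diagonal {zero} _ =
    ⊥-elim (r′≢r (diagonal r′ r (in-H , _ , ε , r′ , r , refl , inj₂ (r′≢r , st))))

  admissible-nodes : List (ℕ × ℕ)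
  admissible-nodes = map (λ r → r , r) (filter (λ r → M ∣? β * r) (upTo k))

  ∈-admissible-nodes⇔young : YoungExists g k → Diagonal g k →
    ∀ s r → ((s , r) ∈ admissible-nodes) ⇔ YoungNode g k (nd s r)
  ∈-admissible-nodes⇔young exists diagonal s r = mk⇔ to from
    where
    to : (s , r) ∈ admissible-nodes → YoungNode g k (nd s r)
    to s,r∈ with x , x∈ , refl , M∣βx ← ∈-map∘filter⁻ (λ r → r , r) (λ r → M ∣? β * r) s,r∈ =
      admissible⇒young exists diagonal (∈-upTo⁻ x∈ , M∣βx)
    from : YoungNode g k (nd s r) → (s , r) ∈ admissible-nodes
    from y with refl , r<k , M∣βr ← young⇒balanced diagonal y =
      ∈-map∘filter⁺ (λ r → r , r) (λ r → M ∣? β * r) (r , ∈-upTo⁺ r<k , refl , M∣βr)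

  balanced-edge : ∀ {s r s′ r′} → Balanced (nd s r) → Balanced (nd s′ r′) →
    ∃₂ λ c a → Edge g k (nd s r) c a (nd s′ r′)
  balanced-edge (refl , ar) (refl , ar′) = diagonal-edge ar ar′

  balanced-start-edge : ∀ {s r} → Balanced (nd s r) → ¬ (s ≡ 0 × r ≡ 0) → Step g k start (nd s r)
  balanced-start-edge (refl , ar) nonzero = start-edge (λ r≡0 → nonzero (r≡0 , r≡0)) ar

  diagonal⇒complete : YoungExists g k → Diagonal g k → ∃ (IsComplete g k)
  diagonal⇒complete exists diagonal =
    length admissible-nodes ,
    (admissible-nodes , refl , unique , ∈-admissible-nodes⇔young exists diagonal) ,
    (λ s r s′ r′ y y′ →
      let c , a , e = balanced-edge {s} {r} {s′} {r′} (young⇒balanced diagonal y) (young⇒balanced diagonal y′)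
      in (c , a) , e , λ c′ a′ e′ → edge-label-unique k*k≡1+M {u = nd s r} {c′ = c′} {a′ = a′} e e′) ,
    (λ s r y → balanced-start-edge {s} {r} (young⇒balanced diagonal y))
    where
    unique = Unique.map⁺ (cong proj₁) (Unique.filter⁺ (λ r → M ∣? β * r) (Unique.upTo⁺ k))

theorem5 : (g k : ℕ) → 3 ≤ g → 2 ≤ k → k < g → YoungExists g k →
    (∃ λ m → IsComplete g k m) ⇔ (∀ s r → YoungNode g k (nd s r) → s ≡ r)
theorem5 g (suc (suc p)) _ (s≤s (s≤s _)) k<g exists with o , refl ← <⇒∃[o]m+1+o≡n k<g =
  mk⇔ (complete⇒diagonal k*k≡1+M) (DiagonalYoungGraph.diagonal⇒complete {β = suc o} k*k≡1+M exists)
  where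
  k*k≡1+M : (2 + p) * (2 + p) ≡ suc ((1 + p) * (3 + p))
  k*k≡1+M = solve (p ∷ [])
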